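{- Let $G$ be an oriented graph, let $(S,T)$ be a break of $G$, and let $f:V(G)\to\mathbb{Z}_+$. Then there is a 2-kernel $K$ of $G$ such that $f(N^+_G[K])\ge f(V(G))/2$, and such that either $K\subseteq S$, or $K$ consists of some vertex $v\in T$ together with the unique 1-kernel of the non-neighbourhood of $v$.
   Context: A digraph is a finite directed graph with no loops or parallel edges; an oriented graph has no directed cycle of length two. A break of $G$ is a partition $(S,T)$ of $V(G)$ such that $G[S]$ is acyclic (no directed cycle) and $G[T]$ is a tournament. A set is stable if no edge has both ends in it. For $k\ge 1$, a $k$-kernel is a stable set $K$ such that every vertex is reachable from some vertex of $K$ by a directed path of length at most $k$ (length $0$ allowed). Every acyclic digraph has a unique 1-kernel. The non-neighbourhood of a vertex $v$ is the subdigraph induced on the set of vertices different from $v$ and neither in- nor out-neighbours of $v$; for $v\in T$ this set lies in $S$, so it induces an acyclic digraph. $\mathbb{Z}_+$ is the set of nonnegative integers, $f(X)=\sum_{v\in X}f(v)$, and $N^+_G[X]$ is the set of vertices in $X$ or out-neighbours of a vertex of $X$. -}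

module Defs where

open import Data.Nat using (ℕ; zero; suc; _+_; _≤_)
open import Data.Fin using (Fin)
open import Data.Bool using (Bool; true; false; T)
open import Data.Vec using (Vec; []; _∷_; lookup; head; last)
open import Data.Vec.Relation.Unary.Unique.Propositional using (Unique)
open import Data.Vec.Relation.Unary.All using (All)
open import Data.Fin.Subset using (Subset; _∈_; _∉_; _⊆_)
open import Data.Product using (Σ; ∃; _×_; _,_)
open import Data.Sum using (_⊎_)
open import Relation.Nullary using (¬_)
open import Relation.Binary.PropositionalEquality using (_≡_; _≢_)

record Digraph (n : ℕ) : Set where
  field
    adj : Fin n → Fin n → Bool
    loopless : ∀ v → ¬ T (adj v v)

open Digraph public

Edge : ∀ {n} → Digraph n → Fin n → Fin n → Set
Edge G u v = T (adj G u v)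

Oriented : ∀ {n} → Digraph n → Set
Oriented G = ∀ u v → Edge G u v → ¬ Edge G v u

data Consecutive {n} (G : Digraph n) : ∀ {k} → Vec (Fin n) k → Set where
  c-nil  : Consecutive G []
  c-one  : ∀ v → Consecutive G (v ∷ [])
  c-cons : ∀ {k} u v (vs : Vec (Fin n) k) →
           Edge G u v → Consecutive G (v ∷ vs) → Consecutive G (u ∷ v ∷ vs)

CycleIn : ∀ {n} → Digraph n → Subset n → Set
CycleIn {n} G X = Σ ℕ λ k → Σ (Vec (Fin n) (suc k)) λ vs →
  Unique vs × Consecutive G vs × Edge G (last vs) (head vs) × All (_∈ X) vs

AcyclicOn : ∀ {n} → Digraph n → Subset n → Set
AcyclicOn G X = ¬ CycleIn G X

TournamentOn : ∀ {n} → Digraph n → Subset n → Set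
TournamentOn G X = ∀ u v → u ∈ X → v ∈ X → u ≢ v → Edge G u v ⊎ Edge G v u

record Break {n} (G : Digraph n) (S T' : Subset n) : Set where
  field
    partition  : ∀ v → (v ∈ S × v ∉ T') ⊎ (v ∉ S × v ∈ T')
    acyclicS   : AcyclicOn G S
    tournamentT : TournamentOn G T'

Stable : ∀ {n} → Digraph n → Subset n → Set
Stable G K = ∀ u v → u ∈ K → v ∈ K → ¬ Edge G u v

PathIn : ∀ {n} → Digraph n → Subset n → ℕ → Fin n → Fin n → Set
PathIn {n} G X k u v = Σ (Vec (Fin n) (suc k)) λ vs →
  Unique vs × Consecutive G vs × head vs ≡ u × last vs ≡ v × All (_∈ X) vs

KernelIn : ∀ {n} → ℕ → Digraph n → Subset n → Subset n → Set
KernelIn k G X K = K ⊆ X × Stable G K ×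
  (∀ v → v ∈ X → ∃ λ u → u ∈ K × Σ ℕ λ l → l ≤ k × PathIn G X l u v)

full : ∀ {n} → Subset n
full {n} = Data.Fin.Subset.⊤

Kernel : ∀ {n} → ℕ → Digraph n → Subset n → Set
Kernel k G K = KernelIn k G full K

NonNbhd : ∀ {n} → Digraph n → Fin n → Fin n → Set
NonNbhd G v w = w ≢ v × ¬ Edge G v w × ¬ Edge G w v

weight : ∀ {n} → (Fin n → ℕ) → Subset n → ℕ
weight {zero}  f []          = 0
weight {suc n} f (true ∷ X)  = f Fin.zero + weight (λ i → f (Fin.suc i)) X
weight {suc n} f (false ∷ X) = weight (λ i → f (Fin.suc i)) X

InClosedOutNbhd : ∀ {n} → Digraph n → Subset n → Fin n → Set
InClosedOutNbhd G K w = w ∈ K ⊎ ∃ λ u → u ∈ K × Edge G u w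

Represents : ∀ {n} → Subset n → (Fin n → Set) → Set
Represents X P = ∀ w → (w ∈ X → P w) × (P w → w ∈ X)

{-# OPTIONS --safe #-}
module Submission where

-- For a vertex c, let seed c be c together with the 1-kernel L c of the non-neighbours of c
-- inside S (this exists because G[S] is acyclic); seed c is stable, and we write D c for
-- N⁺[seed c].  Starting from any vertex x, move to a vertex w at distance more than two from
-- the current seed: first only inside S, which strictly enlarges S ∩ D, then (once all of S
-- is within distance two) inside T, which strictly enlarges D itself.  The process stops at a
-- vertex p x whose seed is a 2-kernel.  The S-moves keep every visited vertex "feeding" x
-- (an in-neighbour of x whose in-neighbours in S are in-neighbours of x), and this invariant
-- shows that for all x and y either y ∈ D (p x) or x ∈ D (p y).  Averaging f (D (p x))
-- against the weights f x then yields an x with f (D (p x)) ≥ f (V) / 2, and seed (p x) lies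
-- in S when p x ∈ S and is p x plus the kernel of its non-neighbourhood when p x ∈ T.

open import Defs
open import Data.Nat using (ℕ; zero; suc; _+_; _*_; _≤_; z≤n; s≤s)
open import Data.Nat.Properties
  using (+-*-semiring; +-mono-≤; *-monoʳ-≤; *-comm; *-cancelˡ-≤; *-distribˡ-+; +-identityʳ;
         m≤m+n; m≤n+m; ≤-refl; 1+n≰n; module ≤-Reasoning)
open import Algebra.Properties.Semiring.Sum +-*-semiring
  using (sum; sum-cong-≗; ∑-comm; ∑-distrib-+; *-distribˡ-sum; *-distribʳ-sum)
open import Data.Bool using (true; false; if_then_else_)
open import Data.Empty using (⊥-elim)
open import Data.Fin using (Fin; zero; suc; _≟_)
open import Data.Fin.Properties using (any?; all?; injective⇒≤)
open import Data.Fin.Subset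
  using (Subset; _∈_; _∉_; _⊆_; _⊂_; _⊃_; ⁅_⁆; _∪_; _∩_; ⊤; Nonempty) renaming (⊥ to ∅)
open import Data.Fin.Subset.Properties
  using (_∈?_; ∈⊤; ∉⊥; ⊆-min; ⊆-trans; nonempty?; q⊆p∪q;
         x∈⁅x⁆; x∈⁅y⁆⇒x≡y; x∈p∪q⁺; x∈p∪q⁻; x∈p∩q⁺; x∈p∩q⁻)
open import Data.Fin.Subset.Induction using (Acc; acc; ⊂-wellFounded; ⊃-wellFounded)
open import Data.List using (allFin)
open import Data.List.Extrema.Nat using (argmax; f[xs]≤f[argmax])
open import Data.List.Membership.Propositional.Properties using (∈-allFin)
import Data.List.Relation.Unary.All as List
open import Data.Product using (Σ; ∃; ∃₂; _×_; _,_; proj₁; proj₂)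
open import Data.Sum using (_⊎_; inj₁; inj₂)
import Data.Sum as Sum
open import Data.Vec using (Vec; []; _∷_; head; last; lookup; tabulate)
open import Data.Vec.Properties using ([]=⇒lookup; lookup⇒[]=; lookup∘tabulate)
open import Data.Vec.Relation.Unary.All as All using (All; []; _∷_)
open import Data.Vec.Relation.Unary.Any using (Any; here; there)
open import Data.Vec.Relation.Unary.AllPairs using ([]; _∷_)
open import Data.Vec.Relation.Unary.Unique.Propositional using (Unique)
open import Data.Vec.Relation.Unary.Unique.Propositional.Properties using (lookup-injective)
open import Function using (_∘_; id)
open import Relation.Nullary using (¬_; Dec; yes; no; does; ¬?)
open import Relation.Nullary.Decidable using (_×-dec_; _⊎-dec_; T?; dec-true; toSum; decidable-stable)
open import Relation.Unary using (Decidable)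
open import Relation.Binary.PropositionalEquality using (_≡_; _≢_; refl; sym; trans; cong; subst)

-- Opaque, like kernelOfS-nonNbhd and settle below: only the specification is ever used, and
-- unfolding the decision procedures inside these definitions makes type checking blow up.
opaque
  subset : ∀ {n} {P : Fin n → Set} → Decidable P → Subset n
  subset P? = tabulate (does ∘ P?)

  represents : ∀ {n} {P : Fin n → Set} (P? : Decidable P) → Represents (subset P?) P
  represents {P = P} P? w = to , from
    where
    to : w ∈ subset P? → P w
    to w∈ with P? w | trans (sym (lookup∘tabulate (does ∘ P?) w)) ([]=⇒lookup w∈)
    ... | yes p | _ = p
    ... | no _  | ()
    from : P w → w ∈ subset P?
    from p = lookup⇒[]= w _ (trans (lookup∘tabulate (does ∘ P?) w) (dec-true (P? w) p))

∈⁅⁆∪⁻ : ∀ {n} {v w : Fin n} {L} → w ∈ ⁅ v ⁆ ∪ L → w ≡ v ⊎ w ∈ L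
∈⁅⁆∪⁻ {v = v} {L = L} w∈ with x∈p∪q⁻ ⁅ v ⁆ L w∈
... | inj₁ w∈⁅v⁆ = inj₁ (x∈⁅y⁆⇒x≡y v w∈⁅v⁆)
... | inj₂ w∈L   = inj₂ w∈L

∈⁅⁆∪⁺ : ∀ {n} {v w : Fin n} {L} → w ≡ v ⊎ w ∈ L → w ∈ ⁅ v ⁆ ∪ L
∈⁅⁆∪⁺ (inj₁ refl) = x∈p∪q⁺ (inj₁ (x∈⁅x⁆ _))
∈⁅⁆∪⁺ (inj₂ w∈L)  = x∈p∪q⁺ (inj₂ w∈L)

ascend-⊂ : ∀ {n} {A : Set} (μ : A → Subset n) {Inv Done : A → Set} →
  (∀ x → Inv x → Done x ⊎ ∃ λ y → Inv y × μ x ⊂ μ y) →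
  ∀ x → Inv x → ∃ λ y → Inv y × Done y
ascend-⊂ μ {Inv} {Done} step x = go x (⊃-wellFounded (μ x))
  where
  go : ∀ x → Acc _⊃_ (μ x) → Inv x → ∃ λ y → Inv y × Done y
  go x (acc larger) inv with step x inv
  ... | inj₁ done               = x , inv , done
  ... | inj₂ (y , inv′ , μx⊂μy) = go y (larger μx⊂μy) inv′

sum-mono-≤ : ∀ {n} {g h : Fin n → ℕ} → (∀ i → g i ≤ h i) → sum g ≤ sum h
sum-mono-≤ {zero}  g≤h = z≤n
sum-mono-≤ {suc n} g≤h = +-mono-≤ (g≤h zero) (sum-mono-≤ (g≤h ∘ suc))

m*m≤m*n⇒m≤n : ∀ m {n} → m * m ≤ m * n → m ≤ n
m*m≤m*n⇒m≤n zero      _  = z≤n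
m*m≤m*n⇒m≤n m@(suc _) le = *-cancelˡ-≤ m le

restrict : ∀ {n} → Subset n → (Fin n → ℕ) → Fin n → ℕ
restrict X f i = if lookup X i then f i else 0

restrict-∈ : ∀ {n} {X : Subset n} (f : Fin n → ℕ) {i} → i ∈ X → restrict X f i ≡ f i
restrict-∈ f i∈X rewrite []=⇒lookup i∈X = refl

weight≡sum-restrict : ∀ {n} (f : Fin n → ℕ) (X : Subset n) → weight f X ≡ sum (restrict X f)
weight≡sum-restrict f []          = refl
weight≡sum-restrict f (true ∷ X)  = cong (f zero +_) (weight≡sum-restrict (f ∘ suc) X)
weight≡sum-restrict f (false ∷ X) = weight≡sum-restrict (f ∘ suc) X

weight-⊤ : ∀ {n} (f : Fin n → ℕ) → weight f ⊤ ≡ sum f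
weight-⊤ {zero}  f = refl
weight-⊤ {suc n} f = cong (f zero +_) (weight-⊤ (f ∘ suc))

-- With F the total weight and M the largest weight f (A x): by the pairing hypothesis every
-- product f x * f y is counted in ∑ₓ f x * f (A x) or in its transpose, so
-- F * F ≤ 2 * ∑ₓ f x * f (A x) ≤ 2 * F * M.
pairwise-covering⇒half-weight : ∀ {n} (f : Fin (suc n) → ℕ) (A : Fin (suc n) → Subset (suc n)) →
  (∀ x y → y ∈ A x ⊎ x ∈ A y) →
  ∃ λ x → weight f ⊤ ≤ 2 * weight f (A x)
pairwise-covering⇒half-weight {n} f A covers = best , total≤2*M
  where
  W : Fin (suc n) → ℕ
  W x = weight f (A x)
  best : Fin (suc n)
  best = argmax W zero (allFin (suc n))
  F M : ℕ
  F = sum f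
  M = W best
  W≤M : ∀ x → W x ≤ M
  W≤M x = List.lookup (f[xs]≤f[argmax] {f = W} zero (allFin (suc n))) (∈-allFin x)
  cross : Fin (suc n) → Fin (suc n) → ℕ
  cross x y = f x * restrict (A x) f y
  fxfy≤cross+crossᵀ : ∀ x y → f x * f y ≤ cross x y + cross y x
  fxfy≤cross+crossᵀ x y with covers x y
  ... | inj₁ y∈Ax rewrite restrict-∈ f y∈Ax = m≤m+n _ _
  ... | inj₂ x∈Ay rewrite restrict-∈ f x∈Ay | *-comm (f y) (f x) = m≤n+m _ _
  ∑cross≡f*W : ∀ x → sum (cross x) ≡ f x * W x
  ∑cross≡f*W x = subst (λ w → sum (cross x) ≡ f x * w) (sym (weight≡sum-restrict f (A x)))
                       (sym (*-distribˡ-sum (f x) (restrict (A x) f)))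
  open ≤-Reasoning
  ∑∑cross≤F*M : sum (λ x → sum (cross x)) ≤ F * M
  ∑∑cross≤F*M = begin
    sum (λ x → sum (cross x)) ≡⟨ sum-cong-≗ ∑cross≡f*W ⟩
    sum (λ x → f x * W x)     ≤⟨ sum-mono-≤ (λ x → *-monoʳ-≤ (f x) (W≤M x)) ⟩
    sum (λ x → f x * M)       ≡⟨ sym (*-distribʳ-sum M f) ⟩
    F * M                     ∎
  F*F≤F*2M : F * F ≤ F * (2 * M)
  F*F≤F*2M = begin
    F * F
      ≡⟨ *-distribʳ-sum F f ⟩
    sum (λ x → f x * F)
      ≡⟨ sum-cong-≗ (λ x → *-distribˡ-sum (f x) f) ⟩
    sum (λ x → sum (λ y → f x * f y))
      ≤⟨ sum-mono-≤ (λ x → sum-mono-≤ (fxfy≤cross+crossᵀ x)) ⟩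
    sum (λ x → sum (λ y → cross x y + cross y x))
      ≡⟨ sum-cong-≗ (λ x → ∑-distrib-+ (cross x) (λ y → cross y x)) ⟩
    sum (λ x → sum (cross x) + sum (λ y → cross y x))
      ≡⟨ ∑-distrib-+ (λ x → sum (cross x)) (λ x → sum (λ y → cross y x)) ⟩
    sum (λ x → sum (cross x)) + sum (λ x → sum (λ y → cross y x))
      ≡⟨ cong (sum (λ x → sum (cross x)) +_) (∑-comm (λ x y → cross y x)) ⟩
    sum (λ x → sum (cross x)) + sum (λ y → sum (cross y))
      ≤⟨ +-mono-≤ ∑∑cross≤F*M ∑∑cross≤F*M ⟩
    F * M + F * M
      ≡⟨ cong (λ k → F * M + F * k) (sym (+-identityʳ M)) ⟩
    F * M + F * (M + 0)
      ≡⟨ sym (*-distribˡ-+ F M (M + 0)) ⟩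
    F * (2 * M)
      ∎
  total≤2*M : weight f ⊤ ≤ 2 * M
  total≤2*M = subst (_≤ 2 * M) (sym (weight-⊤ f)) (m*m≤m*n⇒m≤n F F*F≤F*2M)

module DigraphKernels {n} (G : Digraph n) where

  infix 4 _⟶_ _⟶?_

  _⟶_ : Fin n → Fin n → Set
  u ⟶ v = Edge G u v

  _⟶?_ : ∀ u v → Dec (u ⟶ v)
  u ⟶? v = T? (adj G u v)

  ⟶⇒≢ : ∀ {u v} → u ⟶ v → u ≢ v
  ⟶⇒≢ {u} e refl = loopless G u e

  nonNbhd? : ∀ v w → Dec (NonNbhd G v w)
  nonNbhd? v w = ¬? (w ≟ v) ×-dec ¬? (v ⟶? w) ×-dec ¬? (w ⟶? v)

  closedOutNbhd? : ∀ K w → Dec (InClosedOutNbhd G K w)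
  closedOutNbhd? K w = w ∈? K ⊎-dec any? (λ u → u ∈? K ×-dec u ⟶? w)

  N⁺[_] : Subset n → Subset n
  N⁺[ K ] = subset (closedOutNbhd? K)

  N⁺-represents : ∀ K → Represents N⁺[ K ] (InClosedOutNbhd G K)
  N⁺-represents K = represents (closedOutNbhd? K)

  ∈N⁺[]⁺ : ∀ {K w} → InClosedOutNbhd G K w → w ∈ N⁺[ K ]
  ∈N⁺[]⁺ = proj₂ (N⁺-represents _ _)

  ∈N⁺[]⁻ : ∀ {K w} → w ∈ N⁺[ K ] → InClosedOutNbhd G K w
  ∈N⁺[]⁻ = proj₁ (N⁺-represents _ _)

  closedOutNbhd-mono : ∀ {K K′ w} → K ⊆ K′ →
    InClosedOutNbhd G K w → InClosedOutNbhd G K′ w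
  closedOutNbhd-mono K⊆K′ (inj₁ w∈K)            = inj₁ (K⊆K′ w∈K)
  closedOutNbhd-mono K⊆K′ (inj₂ (u , u∈K , u⟶w)) = inj₂ (u , K⊆K′ u∈K , u⟶w)

  ∉closedOutNbhd⇒∉ : ∀ {K w} → ¬ InClosedOutNbhd G K w → w ∉ K
  ∉closedOutNbhd⇒∉ w∉N⁺K w∈K = w∉N⁺K (inj₁ w∈K)

  ∉closedOutNbhd⇒¬⟶ : ∀ {K u w} → ¬ InClosedOutNbhd G K w → u ∈ K → ¬ u ⟶ w
  ∉closedOutNbhd⇒¬⟶ {u = u} w∉N⁺K u∈K u⟶w = w∉N⁺K (inj₂ (u , u∈K , u⟶w))

  EdgeKernelIn : Subset n → Subset n → Set
  EdgeKernelIn X K = K ⊆ X × Stable G K × (∀ v → v ∈ X → InClosedOutNbhd G K v)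

  path₀ : ∀ {X v} → v ∈ X → PathIn G X 0 v v
  path₀ {v = v} v∈X = v ∷ [] , [] ∷ [] , c-one v , refl , refl , v∈X ∷ []

  path₁ : ∀ {X u v} → u ∈ X → v ∈ X → u ⟶ v → PathIn G X 1 u v
  path₁ {u = u} {v} u∈X v∈X u⟶v =
    u ∷ v ∷ [] , (⟶⇒≢ u⟶v ∷ []) ∷ [] ∷ [] , c-cons u v [] u⟶v (c-one v) , refl , refl ,
    u∈X ∷ v∈X ∷ []

  path₂ : Oriented G → ∀ {X u a v} → u ∈ X → a ∈ X → v ∈ X → u ⟶ a → a ⟶ v →
    PathIn G X 2 u v
  path₂ oriented {u = u} {a} {v} u∈X a∈X v∈X u⟶a a⟶v =
    u ∷ a ∷ v ∷ [] , (⟶⇒≢ u⟶a ∷ u≢v ∷ []) ∷ (⟶⇒≢ a⟶v ∷ []) ∷ [] ∷ [] ,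
    c-cons u a _ u⟶a (c-cons a v [] a⟶v (c-one v)) , refl , refl , u∈X ∷ a∈X ∷ v∈X ∷ []
    where
    u≢v : u ≢ v
    u≢v refl = oriented u a u⟶a a⟶v

  edgeKernel⇒kernel₁ : ∀ {X K} → EdgeKernelIn X K → KernelIn 1 G X K
  edgeKernel⇒kernel₁ {X} {K} (K⊆X , stable , absorbs) = K⊆X , stable , reach
    where
    reach : ∀ v → v ∈ X → ∃ λ u → u ∈ K × Σ ℕ λ l → l ≤ 1 × PathIn G X l u v
    reach v v∈X with absorbs v v∈X
    ... | inj₁ v∈K              = v , v∈K , 0 , z≤n , path₀ v∈X
    ... | inj₂ (u , u∈K , u⟶v) = u , u∈K , 1 , ≤-refl , path₁ (K⊆X u∈K) v∈X u⟶v

  stable+absorbs₂⇒kernel₂ : Oriented G → ∀ {K} → Stable G K →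
    (∀ v → InClosedOutNbhd G N⁺[ K ] v) → Kernel 2 G K
  stable+absorbs₂⇒kernel₂ oriented {K} stable absorbs₂ = (λ _ → ∈⊤) , stable , reach
    where
    reach : ∀ v → v ∈ full → ∃ λ u → u ∈ K × Σ ℕ λ l → l ≤ 2 × PathIn G full l u v
    reach v _ with absorbs₂ v
    ... | inj₁ v∈N⁺K with ∈N⁺[]⁻ v∈N⁺K
    ...   | inj₁ v∈K              = v , v∈K , 0 , z≤n , path₀ ∈⊤
    ...   | inj₂ (u , u∈K , u⟶v) = u , u∈K , 1 , s≤s z≤n , path₁ ∈⊤ ∈⊤ u⟶v
    reach v _ | inj₂ (a , a∈N⁺K , a⟶v) with ∈N⁺[]⁻ a∈N⁺K
    ...   | inj₁ a∈K              = a , a∈K , 1 , s≤s z≤n , path₁ ∈⊤ ∈⊤ a⟶v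
    ...   | inj₂ (u , u∈K , u⟶a) =
      u , u∈K , 2 , s≤s (s≤s z≤n) , path₂ oriented ∈⊤ ∈⊤ ∈⊤ u⟶a a⟶v

  stable-insert : ∀ {K s} → Stable G K → (∀ v → v ∈ K → ¬ s ⟶ v × ¬ v ⟶ s) →
    Stable G (⁅ s ⁆ ∪ K)
  stable-insert {K} {s} stable apart u v u∈ v∈ u⟶v with ∈⁅⁆∪⁻ u∈ | ∈⁅⁆∪⁻ v∈
  ... | inj₁ refl | inj₁ refl = loopless G u u⟶v
  ... | inj₁ refl | inj₂ v∈K  = proj₁ (apart v v∈K) u⟶v
  ... | inj₂ u∈K  | inj₁ refl = proj₂ (apart u u∈K) u⟶v
  ... | inj₂ u∈K  | inj₂ v∈K  = stable u v u∈K v∈K u⟶v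

  acyclicOn-⊆ : ∀ {X Y} → X ⊆ Y → AcyclicOn G Y → AcyclicOn G X
  acyclicOn-⊆ X⊆Y acyclic (k , vs , unique , consecutive , closing , inX) =
    acyclic (k , vs , unique , consecutive , closing , All.map X⊆Y inX)

  path-head∈ : ∀ {X k u v} → PathIn G X k u v → u ∈ X
  path-head∈ (_ ∷ _ , _ , _ , refl , _ , u∈X ∷ _) = u∈X

  path+edge⇒cycle : ∀ {X k u v} → PathIn G X k u v → v ⟶ u → CycleIn G X
  path+edge⇒cycle {k = k} (vs , unique , consecutive , refl , refl , inX) v⟶u =
    k , vs , unique , consecutive , v⟶u , inX

  path-extend : ∀ {X k h v u} (p : PathIn G X k h v) →
    u ∈ X → u ⟶ h → All (u ≢_) (proj₁ p) → PathIn G X (suc k) u v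
  path-extend (w ∷ ws , unique , consecutive , refl , last≡v , inX) u∈X u⟶w u∉p =
    _ ∷ w ∷ ws , u∉p ∷ unique , c-cons _ w ws u⟶w consecutive , refl , last≡v , u∈X ∷ inX

  unique-prefix : ∀ {k u} (vs : Vec (Fin n) (suc k)) →
    Unique vs → Consecutive G vs → Any (u ≡_) vs →
    ∃₂ λ l (ws : Vec (Fin n) (suc l)) →
      Unique ws × Consecutive G ws × head ws ≡ head vs × last ws ≡ u ×
      (∀ {P : Fin n → Set} → All P vs → All P ws)
  unique-prefix (v ∷ vs) _ _ (here refl) =
    0 , v ∷ [] , [] ∷ [] , c-one v , refl , refl , λ { (pv ∷ _) → pv ∷ [] }
  unique-prefix (v ∷ []) _ _ (there ())
  unique-prefix (v ∷ w ∷ vs) (v∉ ∷ unique) (c-cons v w vs v⟶w consecutive) (there u∈)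
    with unique-prefix (w ∷ vs) unique consecutive u∈
  ... | l , y ∷ ys , unique′ , consecutive′ , refl , last≡u , keeps =
    suc l , v ∷ y ∷ ys , keeps v∉ ∷ unique′ , c-cons v y ys v⟶w consecutive′ , refl , last≡u ,
    λ { (pv ∷ pvs) → pv ∷ keeps pvs }

  path-prefix : ∀ {X k h v u} (p : PathIn G X k h v) → Any (u ≡_) (proj₁ p) →
    ∃ λ l → PathIn G X l h u
  path-prefix (vs , unique , consecutive , refl , _ , inX) u∈p
    with unique-prefix vs unique consecutive u∈p
  ... | l , ws , unique′ , consecutive′ , head≡ , last≡u , keeps =
    l , ws , unique′ , consecutive′ , head≡ , last≡u , keeps inX

  -- Without a source, walking backwards from x along in-neighbours either closes a cycle or
  -- yields a path with n + 1 distinct vertices.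
  acyclic⇒source : ∀ {X} → AcyclicOn G X → Nonempty X →
    ∃ λ s → s ∈ X × (∀ u → u ∈ X → ¬ u ⟶ s)
  acyclic⇒source {X} acyclic (x , x∈X)
    with any? (λ s → s ∈? X ×-dec all? (λ u → ¬? (u ∈? X ×-dec u ⟶? s)))
  ... | yes (s , s∈X , noIn) = s , s∈X , λ u u∈X u⟶s → noIn u (u∈X , u⟶s)
  ... | no noSource = ⊥-elim (1+n≰n (pathLength≤ (proj₂ (backwardPath n))))
    where
    inNbr : ∀ s → s ∈ X → ∃ λ u → u ∈ X × u ⟶ s
    inNbr s s∈X with any? (λ u → u ∈? X ×-dec u ⟶? s)
    ... | yes (u , u∈X , u⟶s) = u , u∈X , u⟶s
    ... | no none = ⊥-elim (noSource (s , s∈X , λ u u∈X,u⟶s → none (u , u∈X,u⟶s)))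
    backwardPath : ∀ k → ∃ λ h → PathIn G X k h x
    backwardPath zero = x , path₀ x∈X
    backwardPath (suc k) with backwardPath k
    ... | h , p with inNbr h (path-head∈ p)
    ...   | u , u∈X , u⟶h with All.decide (λ v → Sum.swap (toSum (u ≟ v))) (proj₁ p)
    ...     | inj₁ u∉p = u , path-extend p u∈X u⟶h u∉p
    ...     | inj₂ u∈p = ⊥-elim (acyclic (path+edge⇒cycle (proj₂ (path-prefix p u∈p)) u⟶h))
    pathLength≤ : ∀ {k u v} → PathIn G X k u v → suc k ≤ n
    pathLength≤ (vs , unique , _) = injective⇒≤ λ {i} {j} → lookup-injective unique i j

  outsideN⁺? : ∀ X s v → Dec (v ∈ X × v ≢ s × ¬ s ⟶ v)
  outsideN⁺? X s v = v ∈? X ×-dec ¬? (v ≟ s) ×-dec ¬? (s ⟶? v)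

  _∖N⁺[_] : Subset n → Fin n → Subset n
  X ∖N⁺[ s ] = subset (outsideN⁺? X s)

  ∈∖N⁺[]⁻ : ∀ {X s v} → v ∈ X ∖N⁺[ s ] → v ∈ X × v ≢ s × ¬ s ⟶ v
  ∈∖N⁺[]⁻ = proj₁ (represents (outsideN⁺? _ _) _)

  ∈∖N⁺[]⁺ : ∀ {X s v} → v ∈ X × v ≢ s × ¬ s ⟶ v → v ∈ X ∖N⁺[ s ]
  ∈∖N⁺[]⁺ = proj₂ (represents (outsideN⁺? _ _) _)

  ∖N⁺[]⊂ : ∀ {X s} → s ∈ X → X ∖N⁺[ s ] ⊂ X
  ∖N⁺[]⊂ s∈X = proj₁ ∘ ∈∖N⁺[]⁻ , _ , s∈X , λ s∈X∖N⁺[s] → proj₁ (proj₂ (∈∖N⁺[]⁻ s∈X∖N⁺[s])) refl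

  source+kernel⇒kernel : ∀ {X K s} → s ∈ X → (∀ u → u ∈ X → ¬ u ⟶ s) →
    EdgeKernelIn (X ∖N⁺[ s ]) K → EdgeKernelIn X (⁅ s ⁆ ∪ K)
  source+kernel⇒kernel {X} {K} {s} s∈X source (K⊆rest , stable , absorbs) =
    K′⊆X , stable-insert stable apart , absorbs′
    where
    K′⊆X : ⁅ s ⁆ ∪ K ⊆ X
    K′⊆X v∈K′ with ∈⁅⁆∪⁻ v∈K′
    ... | inj₁ refl = s∈X
    ... | inj₂ v∈K  = proj₁ (∈∖N⁺[]⁻ (K⊆rest v∈K))
    apart : ∀ v → v ∈ K → ¬ s ⟶ v × ¬ v ⟶ s
    apart v v∈K = let (v∈X , _ , ¬s⟶v) = ∈∖N⁺[]⁻ (K⊆rest v∈K) in ¬s⟶v , source v v∈X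
    absorbs′ : ∀ v → v ∈ X → InClosedOutNbhd G (⁅ s ⁆ ∪ K) v
    absorbs′ v v∈X with v ≟ s | s ⟶? v
    ... | yes refl | _         = inj₁ (∈⁅⁆∪⁺ (inj₁ refl))
    ... | no _     | yes s⟶v  = inj₂ (s , ∈⁅⁆∪⁺ (inj₁ refl) , s⟶v)
    ... | no v≢s   | no ¬s⟶v = closedOutNbhd-mono (q⊆p∪q ⁅ s ⁆ K)
                                   (absorbs v (∈∖N⁺[]⁺ (v∈X , v≢s , ¬s⟶v)))

  acyclic⇒edgeKernel : ∀ {X} → AcyclicOn G X → ∃ (EdgeKernelIn X)
  acyclic⇒edgeKernel {X} = go X (⊂-wellFounded X)
    where
    go : ∀ X → Acc _⊂_ X → AcyclicOn G X → ∃ (EdgeKernelIn X)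
    go X (acc smaller) acyclic with nonempty? X
    ... | no empty =
      ∅ , ⊆-min X , (λ _ _ u∈∅ → ⊥-elim (∉⊥ u∈∅)) , λ v v∈X → ⊥-elim (empty (v , v∈X))
    ... | yes nonempty with acyclic⇒source acyclic nonempty
    ...   | s , s∈X , source
      with go (X ∖N⁺[ s ]) (smaller (∖N⁺[]⊂ s∈X)) (acyclicOn-⊆ (proj₁ (∖N⁺[]⊂ s∈X)) acyclic)
    ...     | K , kernel = ⁅ s ⁆ ∪ K , source+kernel⇒kernel s∈X source kernel

module BreakArgument {n} {G : Digraph n} (oriented : Oriented G)
                     {S T : Subset n} (brk : Break G S T) where

  open DigraphKernels G
  open Break brk

  S⊎T : ∀ v → v ∈ S ⊎ v ∈ T
  S⊎T v = Sum.map proj₁ proj₂ (partition v)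

  nonNbhd-of-T⊆S : ∀ {c x} → c ∈ T → NonNbhd G c x → x ∈ S
  nonNbhd-of-T⊆S {c} {x} c∈T (x≢c , ¬c⟶x , ¬x⟶c) with S⊎T x
  ... | inj₁ x∈S = x∈S
  ... | inj₂ x∈T = ⊥-elim (Sum.[ ¬x⟶c , ¬c⟶x ] (tournamentT x c x∈T c∈T x≢c))

  S-nonNbhd? : ∀ c x → Dec (x ∈ S × NonNbhd G c x)
  S-nonNbhd? c x = x ∈? S ×-dec nonNbhd? c x

  S-nonNbhd : Fin n → Subset n
  S-nonNbhd c = subset (S-nonNbhd? c)

  ∈S-nonNbhd⁻ : ∀ {c x} → x ∈ S-nonNbhd c → x ∈ S × NonNbhd G c x
  ∈S-nonNbhd⁻ = proj₁ (represents (S-nonNbhd? _) _)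

  ∈S-nonNbhd⁺ : ∀ {c x} → x ∈ S × NonNbhd G c x → x ∈ S-nonNbhd c
  ∈S-nonNbhd⁺ = proj₂ (represents (S-nonNbhd? _) _)

  opaque
    kernelOfS-nonNbhd : ∀ c → ∃ (EdgeKernelIn (S-nonNbhd c))
    kernelOfS-nonNbhd c = acyclic⇒edgeKernel (acyclicOn-⊆ (proj₁ ∘ ∈S-nonNbhd⁻) acyclicS)

  L : Fin n → Subset n
  L c = proj₁ (kernelOfS-nonNbhd c)

  L-kernel : ∀ c → EdgeKernelIn (S-nonNbhd c) (L c)
  L-kernel c = proj₂ (kernelOfS-nonNbhd c)

  L-nonNbhd : ∀ {c v} → v ∈ L c → v ∈ S × NonNbhd G c v
  L-nonNbhd {c} v∈L = ∈S-nonNbhd⁻ (proj₁ (L-kernel c) v∈L)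

  L-absorbs : ∀ {c x} → x ∈ S → NonNbhd G c x → InClosedOutNbhd G (L c) x
  L-absorbs {c} {x} x∈S x∉N[c] = proj₂ (proj₂ (L-kernel c)) x (∈S-nonNbhd⁺ (x∈S , x∉N[c]))

  seed : Fin n → Subset n
  seed c = ⁅ c ⁆ ∪ L c

  D : Fin n → Subset n
  D c = N⁺[ seed c ]

  seed-stable : ∀ c → Stable G (seed c)
  seed-stable c = stable-insert (proj₁ (proj₂ (L-kernel c))) λ v v∈L →
    let (_ , _ , ¬c⟶v , ¬v⟶c) = L-nonNbhd v∈L in ¬c⟶v , ¬v⟶c

  L⊆seed : ∀ {c} → L c ⊆ seed c
  L⊆seed {c} = q⊆p∪q ⁅ c ⁆ (L c)

  c∈D : ∀ {c} → c ∈ D c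
  c∈D = ∈N⁺[]⁺ (inj₁ (∈⁅⁆∪⁺ (inj₁ refl)))

  ⟶∈D : ∀ {c w} → c ⟶ w → w ∈ D c
  ⟶∈D {c} c⟶w = ∈N⁺[]⁺ (inj₂ (c , ∈⁅⁆∪⁺ (inj₁ refl) , c⟶w))

  L⟶∈D : ∀ {c u w} → u ∈ L c → u ⟶ w → w ∈ D c
  L⟶∈D {u = u} u∈L u⟶w = ∈N⁺[]⁺ (inj₂ (u , L⊆seed u∈L , u⟶w))

  S-¬⟶⇒∈D : ∀ {s c} → s ∈ S → ¬ s ⟶ c → s ∈ D c
  S-¬⟶⇒∈D {s} {c} s∈S ¬s⟶c with s ≟ c | c ⟶? s
  ... | yes refl | _         = c∈D
  ... | no _     | yes c⟶s  = ⟶∈D c⟶s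
  ... | no s≢c   | no ¬c⟶s =
    ∈N⁺[]⁺ (closedOutNbhd-mono L⊆seed (L-absorbs s∈S (s≢c , ¬c⟶s , ¬s⟶c)))

  S-∉D⇒⟶ : ∀ {s c} → s ∈ S → s ∉ D c → s ⟶ c
  S-∉D⇒⟶ {s} {c} s∈S s∉Dc = decidable-stable (s ⟶? c) (s∉Dc ∘ S-¬⟶⇒∈D s∈S)

  ¬⟶T⇒∈D : ∀ {a c} → c ∈ T → ¬ a ⟶ c → a ∈ D c
  ¬⟶T⇒∈D {a} {c} c∈T ¬a⟶c with S⊎T a | a ≟ c
  ... | inj₁ a∈S | _        = S-¬⟶⇒∈D a∈S ¬a⟶c
  ... | inj₂ _   | yes refl = c∈D
  ... | inj₂ a∈T | no a≢c   = Sum.[ ⊥-elim ∘ ¬a⟶c , ⟶∈D ]′ (tournamentT a c a∈T c∈T a≢c)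

  D-total : ∀ x y → y ∈ D x ⊎ x ∈ D y
  D-total x y with x ⟶? y
  ... | yes x⟶y = inj₁ (⟶∈D x⟶y)
  ... | no ¬x⟶y with S⊎T x | y ⟶? x
  ...   | inj₁ x∈S | _         = inj₂ (S-¬⟶⇒∈D x∈S ¬x⟶y)
  ...   | inj₂ _   | yes y⟶x  = inj₂ (⟶∈D y⟶x)
  ...   | inj₂ x∈T | no ¬y⟶x = inj₁ (¬⟶T⇒∈D x∈T ¬y⟶x)

  Reaches : Fin n → Fin n → Set
  Reaches c w = InClosedOutNbhd G (D c) w

  reaches? : ∀ c w → Dec (Reaches c w)
  reaches? c = closedOutNbhd? (D c)

  S∩D-grows : ∀ {c w} → w ∈ S → ¬ Reaches c w → S ∩ D c ⊂ S ∩ D w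
  S∩D-grows {c} {w} w∈S far =
    S∩Dc⊆S∩Dw , w , x∈p∩q⁺ (w∈S , c∈D) , far ∘ inj₁ ∘ proj₂ ∘ x∈p∩q⁻ S (D c)
    where
    S∩Dc⊆S∩Dw : S ∩ D c ⊆ S ∩ D w
    S∩Dc⊆S∩Dw s∈ with x∈p∩q⁻ S (D c) s∈
    ... | s∈S , s∈Dc = x∈p∩q⁺ (s∈S , S-¬⟶⇒∈D s∈S (∉closedOutNbhd⇒¬⟶ far s∈Dc))

  D-grows : ∀ {c w} → w ∈ T → ¬ Reaches c w → D c ⊂ D w
  D-grows w∈T far =
    (λ a∈Dc → ¬⟶T⇒∈D w∈T (∉closedOutNbhd⇒¬⟶ far a∈Dc)) , _ , c∈D , ∉closedOutNbhd⇒∉ far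

  Feeds : Fin n → Fin n → Set
  Feeds a o = a ∈ S × a ⟶ o × (∀ u → u ∈ S → u ⟶ a → u ⟶ o)

  feeds-trans : ∀ {a b c} → Feeds a b → Feeds b c → Feeds a c
  feeds-trans (a∈S , a⟶b , into-a) (_ , b⟶c , into-b) =
    a∈S , into-b _ a∈S a⟶b , λ u u∈S u⟶a → into-b u u∈S (into-a u u∈S u⟶a)

  S-step-feeds : ∀ {c w} → w ∈ S → ¬ Reaches c w → Feeds w c
  S-step-feeds w∈S far =
    w∈S , S-∉D⇒⟶ w∈S (∉closedOutNbhd⇒∉ far) ,
    λ u u∈S u⟶w → S-∉D⇒⟶ u∈S (λ u∈Dc → ∉closedOutNbhd⇒¬⟶ far u∈Dc u⟶w)

  feeds⇒∈D : ∀ {a o z} → Feeds a o → NonNbhd G z a → o ∈ D z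
  feeds⇒∈D (a∈S , a⟶o , into-a) a∉N[z] with L-absorbs a∈S a∉N[z]
  ... | inj₁ a∈L              = L⟶∈D a∈L a⟶o
  ... | inj₂ (u , u∈L , u⟶a) = L⟶∈D u∈L (into-a u (proj₁ (L-nonNbhd u∈L)) u⟶a)

  data Chain (o : Fin n) : Fin n → Set where
    start : Chain o o
    step  : ∀ {c w} → Chain o c → w ∈ S → ¬ Reaches c w → Chain o w

  step-feeds : ∀ {o c w} → Chain o c → w ∈ S → ¬ Reaches c w → Feeds w o
  step-feeds start                 w∈S far = S-step-feeds w∈S far
  step-feeds (step chain v∈S far′) w∈S far =
    feeds-trans (S-step-feeds w∈S far) (step-feeds chain v∈S far′)

  -- z left D somewhere along a chain from o, namely at the step to a.
  Lost : Fin n → Fin n → Set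
  Lost o z = ∃ λ a → Feeds a o × NonNbhd G z a × z ∉ D a

  chain-loss : ∀ {o c z} → Chain o c → z ∈ D o → z ∈ D c ⊎ Lost o z
  chain-loss start z∈Do = inj₁ z∈Do
  chain-loss {z = z} (step {c} {w} chain w∈S far) z∈Do with chain-loss chain z∈Do
  ... | inj₂ lost = inj₂ lost
  ... | inj₁ z∈Dc with z ∈? D w
  ...   | yes z∈Dw = inj₁ z∈Dw
  ...   | no z∉Dw  =
    inj₂ (w , step-feeds chain w∈S far , (w≢z , ∉closedOutNbhd⇒¬⟶ far z∈Dc , z∉Dw ∘ ⟶∈D) , z∉Dw)
    where
    w≢z : w ≢ z
    w≢z refl = ∉closedOutNbhd⇒∉ far z∈Dc

  lost⇒∈D : ∀ {o z} → Lost o z → o ∈ D z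
  lost⇒∈D (_ , a-feeds-o , a∉N[z] , _) = feeds⇒∈D a-feeds-o a∉N[z]

  lost-asym : ∀ {x y} → Lost x y → ¬ Lost y x
  lost-asym (a , (a∈S , a⟶x , into-a) , (_ , _ , ¬a⟶y) , y∉Da)
            (b , b-feeds-y@(b∈S , _ , into-b) , (_ , _ , ¬b⟶x) , _) =
    y∉Da (feeds⇒∈D b-feeds-y (b≢a , ¬a⟶y ∘ into-b a a∈S , ¬b⟶x ∘ into-a b b∈S))
    where
    b≢a : b ≢ a
    b≢a refl = ¬b⟶x a⟶x

  chain-pairing : ∀ {x y p q} → Chain x p → Chain y q → y ∈ D x → y ∈ D p ⊎ x ∈ D q
  chain-pairing chain-x chain-y y∈Dx with chain-loss chain-x y∈Dx
  ... | inj₁ y∈Dp = inj₁ y∈Dp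
  ... | inj₂ lost-xy with chain-loss chain-y (lost⇒∈D lost-xy)
  ...   | inj₁ x∈Dq    = inj₂ x∈Dq
  ...   | inj₂ lost-yx = ⊥-elim (lost-asym lost-xy lost-yx)

  S-phase : ∀ o → ∃ λ m → Chain o m × (∀ w → w ∈ S → Reaches m w)
  S-phase o = ascend-⊂ (λ c → S ∩ D c) grow o start
    where
    grow : ∀ c → Chain o c →
      (∀ w → w ∈ S → Reaches c w) ⊎ ∃ λ w → Chain o w × S ∩ D c ⊂ S ∩ D w
    grow c chain with any? (λ w → w ∈? S ×-dec ¬? (reaches? c w))
    ... | yes (w , w∈S , far) = inj₂ (w , step chain w∈S far , S∩D-grows w∈S far)
    ... | no none = inj₁ λ w w∈S → decidable-stable (reaches? c w) (λ far → none (w , w∈S , far))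

  T-phase : ∀ m → (∀ w → w ∈ S → Reaches m w) →
    ∃ λ p → D m ⊆ D p × (∀ w → Reaches p w)
  T-phase m absorbsS =
    let p , (_ , Dm⊆Dp) , absorbs = ascend-⊂ D grow m (absorbsS , id) in p , Dm⊆Dp , absorbs
    where
    Inv : Fin n → Set
    Inv c = (∀ w → w ∈ S → Reaches c w) × D m ⊆ D c
    grow : ∀ c → Inv c → (∀ w → Reaches c w) ⊎ ∃ λ w → Inv w × D c ⊂ D w
    grow c (absorbsS′ , Dm⊆Dc) with any? (λ w → ¬? (reaches? c w))
    ... | no none = inj₁ λ w → decidable-stable (reaches? c w) (λ far → none (w , far))
    ... | yes (w , far) with S⊎T w
    ...   | inj₁ w∈S = ⊥-elim (far (absorbsS′ w w∈S))
    ...   | inj₂ w∈T =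
      inj₂ (w , ((λ s s∈S → closedOutNbhd-mono Dc⊆Dw (absorbsS′ s s∈S)) , ⊆-trans Dm⊆Dc Dc⊆Dw) , Dc⊂Dw)
      where
      Dc⊂Dw : D c ⊂ D w
      Dc⊂Dw = D-grows w∈T far
      Dc⊆Dw : D c ⊆ D w
      Dc⊆Dw = proj₁ Dc⊂Dw

  record Settled (x : Fin n) : Set where
    field
      middle end     : Fin n
      chainToMiddle  : Chain x middle
      D-middle⊆D-end : D middle ⊆ D end
      end-absorbs₂   : ∀ w → Reaches end w

  open Settled

  opaque
    settle : ∀ x → Settled x
    settle x with S-phase x
    ... | m , chain , absorbsS with T-phase m absorbsS
    ...   | p , Dm⊆Dp , absorbs₂ = record
      { middle = m ; end = p ; chainToMiddle = chain ; D-middle⊆D-end = Dm⊆Dp ; end-absorbs₂ = absorbs₂ }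

  settled-pairing : ∀ {x y} (sx : Settled x) (sy : Settled y) → y ∈ D (end sx) ⊎ x ∈ D (end sy)
  settled-pairing {x} {y} sx sy with D-total x y
  ... | inj₁ y∈Dx = Sum.map (D-middle⊆D-end sx) (D-middle⊆D-end sy)
                      (chain-pairing (chainToMiddle sx) (chainToMiddle sy) y∈Dx)
  ... | inj₂ x∈Dy = Sum.swap (Sum.map (D-middle⊆D-end sy) (D-middle⊆D-end sx)
                      (chain-pairing (chainToMiddle sy) (chainToMiddle sx) x∈Dy))

  endpoint : Fin n → Fin n
  endpoint x = end (settle x)

  endpoint-pairing : ∀ x y → y ∈ D (endpoint x) ⊎ x ∈ D (endpoint y)
  endpoint-pairing x y = settled-pairing (settle x) (settle y)

  endpoint-kernel₂ : ∀ x → Kernel 2 G (seed (endpoint x))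
  endpoint-kernel₂ x = stable+absorbs₂⇒kernel₂ oriented (seed-stable _) (end-absorbs₂ (settle x))

  seed-shape : ∀ c → seed c ⊆ S ⊎
    (Σ (Fin n) λ v → v ∈ T × Σ (Subset n) λ U → Σ (Subset n) λ L′ →
      Represents U (NonNbhd G v) × KernelIn 1 G U L′ × Represents (seed c) (λ w → w ≡ v ⊎ w ∈ L′))
  seed-shape c with S⊎T c
  ... | inj₁ c∈S = inj₁ seed⊆S
    where
    seed⊆S : seed c ⊆ S
    seed⊆S w∈ with ∈⁅⁆∪⁻ w∈
    ... | inj₁ refl = c∈S
    ... | inj₂ w∈L  = proj₁ (L-nonNbhd w∈L)
  ... | inj₂ c∈T =
    inj₂ (c , c∈T , S-nonNbhd c , L c , U-represents , edgeKernel⇒kernel₁ (L-kernel c) ,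
          λ w → ∈⁅⁆∪⁻ , ∈⁅⁆∪⁺)
    where
    U-represents : Represents (S-nonNbhd c) (NonNbhd G c)
    U-represents w =
      proj₂ ∘ ∈S-nonNbhd⁻ , λ w∉N[c] → ∈S-nonNbhd⁺ (nonNbhd-of-T⊆S c∈T w∉N[c] , w∉N[c])

mainTheorem5 : ∀ {n} (G : Digraph n) → Oriented G →
    (S T : Subset n) → Break G S T → (f : Fin n → ℕ) →
    Σ (Subset n) λ K → Kernel 2 G K ×
      (Σ (Subset n) λ N → Represents N (InClosedOutNbhd G K) × weight f ⊤ ≤ 2 * weight f N) ×
      (K ⊆ S ⊎
        (Σ (Fin n) λ v → v ∈ T × Σ (Subset n) λ U → Σ (Subset n) λ L →
          Represents U (NonNbhd G v) × KernelIn 1 G U L ×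
          Represents K (λ w → w ≡ v ⊎ w ∈ L)))
mainTheorem5 {zero} G _ S T _ f = ∅ , ((λ ()) , (λ ()) , λ ()) , (∅ , (λ ()) , z≤n) , inj₁ (λ ())
mainTheorem5 {suc n} G oriented S T brk f =
  seed p , endpoint-kernel₂ x , (D p , N⁺-represents (seed p) , heavy) , seed-shape p
  where
  open BreakArgument oriented brk
  open DigraphKernels G using (N⁺-represents)
  halfWeight : ∃ λ x → weight f ⊤ ≤ 2 * weight f (D (endpoint x))
  halfWeight = pairwise-covering⇒half-weight f (D ∘ endpoint) endpoint-pairing
  x p : Fin (suc n)
  x = proj₁ halfWeight
  p = endpoint x
  heavy : weight f ⊤ ≤ 2 * weight f (D p)
  heavy = proj₂ halfWeight
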